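{- Let $G$ be a connected $\{\mathcal{F},\textsf{odd-holes}_7\}$-free graph that contains an induced subgraph isomorphic to $C_5$. Then $G=C_5$.
   Context: All graphs are finite, simple and connected. A graph is $\mathcal{G}$-free if none of its induced subgraphs is isomorphic to a member of $\mathcal{G}$. $\textsf{odd-holes}_7$ denotes the set of cycles $C_k$ with $k$ odd and $k\ge 7$. $\mathcal{F}$ is the following set of 16 graphs: bull (triangle $abc$ plus vertices $d,e$ with $d$ adjacent only to $a$ and $e$ adjacent only to $b$); dart ($K_4$ minus an edge, plus a pendant vertex attached to one of its two degree-3 vertices); house ($C_5$ plus one chord); gem ($P_4$ plus a vertex adjacent to all four of its vertices); full-house ($K_4$ plus a vertex adjacent to exactly two vertices of the $K_4$); $G_{6,5}$ (vertices $a,\dots,f$, edges $ab,ac,bc,cd,ce,ef$); 5-pan ($C_5$ plus a pendant vertex); $G_{6,7}$ (edges $ab,ac,bc,cd,de,ef$); $G_{6,8}$ (edges $ab,ac,ad,ae,af,bc,de$); $G_{6,9}$ (edges $ab,ac,bc,bd,cd,de,df$); $G_{6,10}$ (edges $ab,bc,cd,de,ea,fb,fd$); co-twin-house (edges $ab,ac,ad,bc,bd,ce,df$); $G_{6,12}$ (edges $ab,ac,ad,bc,bd,ce,de,df$); co-twin-$C_5$ (edges $ab,bc,cd,de,ea,fb,fc,fd$); $G_{6,14}=K_{2,2,1,1}$; $G_{6,15}$ (vertices $a,\dots,g$, edges $ab,ac,bc,ad,ae,df,dg,ef,eg$). -}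

module Defs where

open import Data.Nat using (ℕ; zero; suc; _≡ᵇ_; _%_; _≤_)
open import Data.Nat.Properties using ()
open import Data.Fin using (Fin; toℕ; #_)
open import Data.Bool using (Bool; true; false; _∨_; _∧_)
open import Data.List using (List; []; _∷_)
open import Data.Bool.ListAction using (any)
open import Data.List.Relation.Unary.All using (All)
open import Data.Product using (Σ; _×_; _,_; ∃)
open import Relation.Binary.PropositionalEquality using (_≡_)
open import Relation.Nullary using (¬_)
open import Function.Definitions using (Injective; Bijective)

AdjRel : ℕ → Set
AdjRel k = Fin k → Fin k → Bool

record Graph : Set where
  field
    n     : ℕ
    adj   : AdjRel n
    sym   : ∀ u v → adj u v ≡ adj v u
    irref : ∀ u → adj u u ≡ false
open Graph public

data Walk (G : Graph) : Fin (n G) → Fin (n G) → Set where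
  here : ∀ {u} → Walk G u u
  step : ∀ {u v w} → adj G u v ≡ true → Walk G v w → Walk G u w

Connected : Graph → Set
Connected G = ∀ u v → Walk G u v

HasInduced : (G : Graph) (k : ℕ) → AdjRel k → Set
HasInduced G k H =
  Σ (Fin k → Fin (n G)) λ f →
    Injective _≡_ _≡_ f × (∀ i j → adj G (f i) (f j) ≡ H i j)

IsoTo : (G : Graph) (k : ℕ) → AdjRel k → Set
IsoTo G k H =
  Σ (Fin k → Fin (n G)) λ f →
    Bijective _≡_ _≡_ f × (∀ i j → adj G (f i) (f j) ≡ H i j)

Pattern : Set
Pattern = Σ ℕ AdjRel

Free : Graph → Pattern → Set
Free G (k , H) = ¬ HasInduced G k H

eqF : ∀ {k} → Fin k → Fin k → Bool
eqF i j = toℕ i ≡ᵇ toℕ j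

fromEdges : (k : ℕ) → List (Fin k × Fin k) → AdjRel k
fromEdges k es i j =
  any (λ { (a , b) → (eqF a i ∧ eqF b j) ∨ (eqF a j ∧ eqF b i) }) es

cycleAdj : (k : ℕ) → AdjRel k
cycleAdj zero ()
cycleAdj (suc m) i j =
  ((suc (toℕ i) % suc m) ≡ᵇ toℕ j) ∨ ((suc (toℕ j) % suc m) ≡ᵇ toℕ i)

data IsOdd : ℕ → Set where
  one  : IsOdd 1
  two+ : ∀ {m} → IsOdd m → IsOdd (suc (suc m))

OddHoles7Free : Graph → Set
OddHoles7Free G = ∀ k → 7 ≤ k → IsOdd k → ¬ HasInduced G k (cycleAdj k)

-- The 16 graphs of the family F (vertices a,b,c,... are # 0, # 1, # 2, ...).
bull dart house gem full-house G65 pan5 G67 G68 G69 G610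
  co-twin-house G612 co-twin-C5 G614 G615 : Pattern
bull = 5 , fromEdges 5 ((# 0 , # 1) ∷ (# 0 , # 2) ∷ (# 1 , # 2) ∷ (# 3 , # 0) ∷ (# 4 , # 1) ∷ [])
-- K4 - cd on a,b,c,d ; degree-3 vertices a,b ; pendant e at a
dart = 5 , fromEdges 5 ((# 0 , # 1) ∷ (# 0 , # 2) ∷ (# 0 , # 3) ∷ (# 1 , # 2) ∷ (# 1 , # 3) ∷ (# 0 , # 4) ∷ [])
house = 5 , fromEdges 5 ((# 0 , # 1) ∷ (# 1 , # 2) ∷ (# 2 , # 3) ∷ (# 3 , # 4) ∷ (# 4 , # 0) ∷ (# 0 , # 2) ∷ [])
gem = 5 , fromEdges 5 ((# 0 , # 1) ∷ (# 1 , # 2) ∷ (# 2 , # 3) ∷ (# 4 , # 0) ∷ (# 4 , # 1) ∷ (# 4 , # 2) ∷ (# 4 , # 3) ∷ [])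
-- K4 abcd plus e adjacent to a,b
full-house = 5 , fromEdges 5 ((# 0 , # 1) ∷ (# 0 , # 2) ∷ (# 0 , # 3) ∷ (# 1 , # 2) ∷ (# 1 , # 3) ∷ (# 2 , # 3) ∷ (# 4 , # 0) ∷ (# 4 , # 1) ∷ [])
G65 = 6 , fromEdges 6 ((# 0 , # 1) ∷ (# 0 , # 2) ∷ (# 1 , # 2) ∷ (# 2 , # 3) ∷ (# 2 , # 4) ∷ (# 4 , # 5) ∷ [])
pan5 = 6 , fromEdges 6 ((# 0 , # 1) ∷ (# 1 , # 2) ∷ (# 2 , # 3) ∷ (# 3 , # 4) ∷ (# 4 , # 0) ∷ (# 5 , # 0) ∷ [])
G67 = 6 , fromEdges 6 ((# 0 , # 1) ∷ (# 0 , # 2) ∷ (# 1 , # 2) ∷ (# 2 , # 3) ∷ (# 3 , # 4) ∷ (# 4 , # 5) ∷ [])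
G68 = 6 , fromEdges 6 ((# 0 , # 1) ∷ (# 0 , # 2) ∷ (# 0 , # 3) ∷ (# 0 , # 4) ∷ (# 0 , # 5) ∷ (# 1 , # 2) ∷ (# 3 , # 4) ∷ [])
G69 = 6 , fromEdges 6 ((# 0 , # 1) ∷ (# 0 , # 2) ∷ (# 1 , # 2) ∷ (# 1 , # 3) ∷ (# 2 , # 3) ∷ (# 3 , # 4) ∷ (# 3 , # 5) ∷ [])
G610 = 6 , fromEdges 6 ((# 0 , # 1) ∷ (# 1 , # 2) ∷ (# 2 , # 3) ∷ (# 3 , # 4) ∷ (# 4 , # 0) ∷ (# 5 , # 1) ∷ (# 5 , # 3) ∷ [])
co-twin-house = 6 , fromEdges 6 ((# 0 , # 1) ∷ (# 0 , # 2) ∷ (# 0 , # 3) ∷ (# 1 , # 2) ∷ (# 1 , # 3) ∷ (# 2 , # 4) ∷ (# 3 , # 5) ∷ [])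
G612 = 6 , fromEdges 6 ((# 0 , # 1) ∷ (# 0 , # 2) ∷ (# 0 , # 3) ∷ (# 1 , # 2) ∷ (# 1 , # 3) ∷ (# 2 , # 4) ∷ (# 3 , # 4) ∷ (# 3 , # 5) ∷ [])
co-twin-C5 = 6 , fromEdges 6 ((# 0 , # 1) ∷ (# 1 , # 2) ∷ (# 2 , # 3) ∷ (# 3 , # 4) ∷ (# 4 , # 0) ∷ (# 5 , # 1) ∷ (# 5 , # 2) ∷ (# 5 , # 3) ∷ [])
-- K_{2,2,1,1} with parts {a,b}, {c,d}, {e}, {f}: all pairs except ab and cd
G614 = 6 , fromEdges 6 ((# 0 , # 2) ∷ (# 0 , # 3) ∷ (# 0 , # 4) ∷ (# 0 , # 5) ∷ (# 1 , # 2) ∷ (# 1 , # 3) ∷ (# 1 , # 4) ∷ (# 1 , # 5)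
                        ∷ (# 2 , # 4) ∷ (# 2 , # 5) ∷ (# 3 , # 4) ∷ (# 3 , # 5) ∷ (# 4 , # 5) ∷ [])
G615 = 7 , fromEdges 7 ((# 0 , # 1) ∷ (# 0 , # 2) ∷ (# 1 , # 2) ∷ (# 0 , # 3) ∷ (# 0 , # 4) ∷ (# 3 , # 5) ∷ (# 3 , # 6) ∷ (# 4 , # 5) ∷ (# 4 , # 6) ∷ [])

𝓕 : List Pattern
𝓕 = bull ∷ dart ∷ house ∷ gem ∷ full-house ∷ G65 ∷ pan5 ∷ G67 ∷ G68 ∷ G69 ∷ G610
    ∷ co-twin-house ∷ G612 ∷ co-twin-C5 ∷ G614 ∷ G615 ∷ []

FFree : Graph → Set
FFree G = All (Free G) 𝓕

-- A vertex outside an induced C₅ whose neighbourhood N on the C₅ is nonempty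
-- induces, together with the C₅, a graph of 𝓕: a 5-pan if |N| = 1, a bull or
-- G₆,₁₀ if |N| = 2, a bull or co-twin-C₅ if |N| = 3, a house if |N| = 4 and a
-- gem if |N| = 5.  So in an 𝓕-free graph no edge leaves an induced C₅, and by
-- connectedness the C₅ is the whole graph.
module Submission where

open import Defs hiding (sym)
open import Data.Nat using (ℕ; suc)
open import Data.Bool using (Bool; true; false)
open import Data.Bool.Properties using () renaming (_≟_ to _≟ᵇ_)
open import Data.Fin using (Fin; zero; suc; #_; _≟_)
open import Data.Fin.Properties using (all?; any?)
open import Data.Vec using (Vec; []; _∷_; lookup; tabulate)
open import Data.Vec.Properties using (lookup∘tabulate)
open import Data.List.Membership.Propositional using (_∈_; lose)
open import Data.List.Relation.Unary.Any using (Any; here; there)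
import Data.List.Relation.Unary.Any as Any
import Data.List.Relation.Unary.All as All
open import Data.List.Relation.Unary.All.Properties using (All¬⇒¬Any)
open import Data.Product using (∃; _×_; _,_)
open import Function.Definitions using (Injective)
open import Function.Consequences.Propositional using (strictlySurjective⇒surjective)
open import Relation.Binary.PropositionalEquality using (_≡_; refl; sym; trans)
open import Relation.Nullary using (Dec; yes; no; ¬_; contradiction)
open import Relation.Nullary.Decidable using (True; toWitness; map′; _×-dec_; _→-dec_)

private
  variable
    k m : ℕ

IsInducedEmbedding : AdjRel k → AdjRel m → (Fin k → Fin m) → Set
IsInducedEmbedding A B σ = Injective _≡_ _≡_ σ × (∀ i j → B (σ i) (σ j) ≡ A i j)

infix 4 _↪_
record _↪_ (A : AdjRel k) (B : AdjRel m) : Set where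
  constructor _,_
  field
    map                : Fin k → Fin m
    isInducedEmbedding : IsInducedEmbedding A B map

HasInduced⇒↪ : (G : Graph) {H : AdjRel k} → HasInduced G k H → H ↪ adj G
HasInduced⇒↪ G (σ , emb) = σ , emb

↪⇒HasInduced : (G : Graph) {H : AdjRel k} → H ↪ adj G → HasInduced G k H
↪⇒HasInduced G (σ , emb) = σ , emb

Contains : AdjRel m → Pattern → Set
Contains B (_ , H) = H ↪ B

FFree⇒¬Contains-𝓕 : (G : Graph) → FFree G → ¬ Any (Contains (adj G)) 𝓕
FFree⇒¬Contains-𝓕 G FF = All¬⇒¬Any (All.map (λ free e → free (↪⇒HasInduced G e)) FF)

↪-trans : {l : ℕ} {A : AdjRel k} {B : AdjRel m} {C : AdjRel l} → A ↪ B → B ↪ C → A ↪ C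
↪-trans (σ , σ-inj , σ-adj) (τ , τ-inj , τ-adj) =
  (λ i → τ (σ i)) , (λ eq → σ-inj (τ-inj eq)) , λ i j → trans (τ-adj (σ i) (σ j)) (σ-adj i j)

injective? : (σ : Fin k → Fin m) → Dec (Injective _≡_ _≡_ σ)
injective? σ = map′ (λ inj {i} {j} → inj i j) (λ inj i j → inj)
  (all? λ i → all? λ j → (σ i ≟ σ j) →-dec (i ≟ j))

isInducedEmbedding? : (A : AdjRel k) (B : AdjRel m) (σ : Fin k → Fin m) →
                      Dec (IsInducedEmbedding A B σ)
isInducedEmbedding? A B σ =
  injective? σ ×-dec all? λ i → all? λ j → B (σ i) (σ j) ≟ᵇ A i j

via : {A : AdjRel k} {B : AdjRel m} (σ : Vec (Fin m) k) →
     {True (isInducedEmbedding? A B (lookup σ))} → A ↪ B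
via σ {ok} = lookup σ , toWitness ok

addVertex : (Fin k → Bool) → AdjRel k → AdjRel (suc k)
addVertex N A zero    zero    = false
addVertex N A zero    (suc j) = N j
addVertex N A (suc i) zero    = N i
addVertex N A (suc i) (suc j) = A i j

addVertex-↪ : {k : ℕ} (G : Graph) {A : AdjRel k} ((f , _) : A ↪ adj G) {v : Fin (n G)} →
              ¬ (∃ λ i → f i ≡ v) → {N : Fin k → Bool} → (∀ i → adj G (f i) v ≡ N i) →
              addVertex N A ↪ adj G
addVertex-↪ {k} G {A} (f , f-inj , f-adj) {v} v∉f {N} N-adj = g , g-inj , g-adj
  where
  g : Fin (suc k) → Fin (n G)
  g zero    = v
  g (suc i) = f i

  g-inj : Injective _≡_ _≡_ g
  g-inj {zero}  {zero}  _  = refl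
  g-inj {zero}  {suc j} eq = contradiction (j , sym eq) v∉f
  g-inj {suc i} {zero}  eq = contradiction (i , eq) v∉f
  g-inj {suc i} {suc j} eq rewrite f-inj eq = refl

  g-adj : ∀ i j → adj G (g i) (g j) ≡ addVertex N A i j
  g-adj zero    zero    = irref G v
  g-adj zero    (suc j) = trans (Graph.sym G v (f j)) (N-adj j)
  g-adj (suc i) zero    = N-adj i
  g-adj (suc i) (suc j) = f-adj i j

bull∈𝓕 : bull ∈ 𝓕
bull∈𝓕 = here refl

house∈𝓕 : house ∈ 𝓕
house∈𝓕 = there (there (here refl))

gem∈𝓕 : gem ∈ 𝓕
gem∈𝓕 = there (there (there (here refl)))

pan5∈𝓕 : pan5 ∈ 𝓕
pan5∈𝓕 = there (there (there (there (there (there (here refl))))))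

G610∈𝓕 : G610 ∈ 𝓕
G610∈𝓕 = there (there (there (there (there (there (there (there (there (there (here refl))))))))))

co-twin-C5∈𝓕 : co-twin-C5 ∈ 𝓕
co-twin-C5∈𝓕 = there (there (there (there (there (there (there (there (there (there (there (there (there (here refl)))))))))))))

-- In a row, σ lists the images of the pattern's vertices a, b, c, … in C₅ + v,
-- where # 0 is the new vertex v and # (i + 1) is vertex i of the C₅.
C₅+vertex-contains-𝓕 : (N : Vec Bool 5) (i : Fin 5) → lookup N i ≡ true →
                      Any (Contains (addVertex (lookup N) (cycleAdj 5))) 𝓕
C₅+vertex-contains-𝓕 (false ∷ false ∷ false ∷ false ∷ false ∷ []) zero ()
C₅+vertex-contains-𝓕 (false ∷ false ∷ false ∷ false ∷ false ∷ []) (suc zero) ()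
C₅+vertex-contains-𝓕 (false ∷ false ∷ false ∷ false ∷ false ∷ []) (suc (suc zero)) ()
C₅+vertex-contains-𝓕 (false ∷ false ∷ false ∷ false ∷ false ∷ []) (suc (suc (suc zero))) ()
C₅+vertex-contains-𝓕 (false ∷ false ∷ false ∷ false ∷ false ∷ []) (suc (suc (suc (suc zero)))) ()
C₅+vertex-contains-𝓕 (false ∷ false ∷ false ∷ false ∷ true ∷ []) _ _ = lose pan5∈𝓕 (via (# 5 ∷ # 1 ∷ # 2 ∷ # 3 ∷ # 4 ∷ # 0 ∷ []))
C₅+vertex-contains-𝓕 (false ∷ false ∷ false ∷ true ∷ false ∷ []) _ _ = lose pan5∈𝓕 (via (# 4 ∷ # 3 ∷ # 2 ∷ # 1 ∷ # 5 ∷ # 0 ∷ []))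
C₅+vertex-contains-𝓕 (false ∷ false ∷ false ∷ true ∷ true ∷ []) _ _ = lose bull∈𝓕 (via (# 4 ∷ # 5 ∷ # 0 ∷ # 3 ∷ # 1 ∷ []))
C₅+vertex-contains-𝓕 (false ∷ false ∷ true ∷ false ∷ false ∷ []) _ _ = lose pan5∈𝓕 (via (# 3 ∷ # 2 ∷ # 1 ∷ # 5 ∷ # 4 ∷ # 0 ∷ []))
C₅+vertex-contains-𝓕 (false ∷ false ∷ true ∷ false ∷ true ∷ []) _ _ = lose G610∈𝓕 (via (# 1 ∷ # 5 ∷ # 4 ∷ # 3 ∷ # 2 ∷ # 0 ∷ []))
C₅+vertex-contains-𝓕 (false ∷ false ∷ true ∷ true ∷ false ∷ []) _ _ = lose bull∈𝓕 (via (# 3 ∷ # 4 ∷ # 0 ∷ # 2 ∷ # 5 ∷ []))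
C₅+vertex-contains-𝓕 (false ∷ false ∷ true ∷ true ∷ true ∷ []) _ _ = lose co-twin-C5∈𝓕 (via (# 1 ∷ # 5 ∷ # 4 ∷ # 3 ∷ # 2 ∷ # 0 ∷ []))
C₅+vertex-contains-𝓕 (false ∷ true ∷ false ∷ false ∷ false ∷ []) _ _ = lose pan5∈𝓕 (via (# 2 ∷ # 1 ∷ # 5 ∷ # 4 ∷ # 3 ∷ # 0 ∷ []))
C₅+vertex-contains-𝓕 (false ∷ true ∷ false ∷ false ∷ true ∷ []) _ _ = lose G610∈𝓕 (via (# 3 ∷ # 2 ∷ # 1 ∷ # 5 ∷ # 4 ∷ # 0 ∷ []))
C₅+vertex-contains-𝓕 (false ∷ true ∷ false ∷ true ∷ false ∷ []) _ _ = lose G610∈𝓕 (via (# 1 ∷ # 2 ∷ # 3 ∷ # 4 ∷ # 5 ∷ # 0 ∷ []))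
C₅+vertex-contains-𝓕 (false ∷ true ∷ false ∷ true ∷ true ∷ []) _ _ = lose bull∈𝓕 (via (# 4 ∷ # 5 ∷ # 0 ∷ # 3 ∷ # 1 ∷ []))
C₅+vertex-contains-𝓕 (false ∷ true ∷ true ∷ false ∷ false ∷ []) _ _ = lose bull∈𝓕 (via (# 2 ∷ # 3 ∷ # 0 ∷ # 1 ∷ # 4 ∷ []))
C₅+vertex-contains-𝓕 (false ∷ true ∷ true ∷ false ∷ true ∷ []) _ _ = lose bull∈𝓕 (via (# 2 ∷ # 3 ∷ # 0 ∷ # 1 ∷ # 4 ∷ []))
C₅+vertex-contains-𝓕 (false ∷ true ∷ true ∷ true ∷ false ∷ []) _ _ = lose co-twin-C5∈𝓕 (via (# 1 ∷ # 2 ∷ # 3 ∷ # 4 ∷ # 5 ∷ # 0 ∷ []))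
C₅+vertex-contains-𝓕 (false ∷ true ∷ true ∷ true ∷ true ∷ []) _ _ = lose house∈𝓕 (via (# 2 ∷ # 3 ∷ # 0 ∷ # 5 ∷ # 1 ∷ []))
C₅+vertex-contains-𝓕 (true ∷ false ∷ false ∷ false ∷ false ∷ []) _ _ = lose pan5∈𝓕 (via (# 1 ∷ # 2 ∷ # 3 ∷ # 4 ∷ # 5 ∷ # 0 ∷ []))
C₅+vertex-contains-𝓕 (true ∷ false ∷ false ∷ false ∷ true ∷ []) _ _ = lose bull∈𝓕 (via (# 1 ∷ # 5 ∷ # 0 ∷ # 2 ∷ # 4 ∷ []))
C₅+vertex-contains-𝓕 (true ∷ false ∷ false ∷ true ∷ false ∷ []) _ _ = lose G610∈𝓕 (via (# 2 ∷ # 1 ∷ # 5 ∷ # 4 ∷ # 3 ∷ # 0 ∷ []))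
C₅+vertex-contains-𝓕 (true ∷ false ∷ false ∷ true ∷ true ∷ []) _ _ = lose co-twin-C5∈𝓕 (via (# 2 ∷ # 1 ∷ # 5 ∷ # 4 ∷ # 3 ∷ # 0 ∷ []))
C₅+vertex-contains-𝓕 (true ∷ false ∷ true ∷ false ∷ false ∷ []) _ _ = lose G610∈𝓕 (via (# 4 ∷ # 3 ∷ # 2 ∷ # 1 ∷ # 5 ∷ # 0 ∷ []))
C₅+vertex-contains-𝓕 (true ∷ false ∷ true ∷ false ∷ true ∷ []) _ _ = lose bull∈𝓕 (via (# 1 ∷ # 5 ∷ # 0 ∷ # 2 ∷ # 4 ∷ []))
C₅+vertex-contains-𝓕 (true ∷ false ∷ true ∷ true ∷ false ∷ []) _ _ = lose bull∈𝓕 (via (# 3 ∷ # 4 ∷ # 0 ∷ # 2 ∷ # 5 ∷ []))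
C₅+vertex-contains-𝓕 (true ∷ false ∷ true ∷ true ∷ true ∷ []) _ _ = lose house∈𝓕 (via (# 1 ∷ # 5 ∷ # 0 ∷ # 3 ∷ # 2 ∷ []))
C₅+vertex-contains-𝓕 (true ∷ true ∷ false ∷ false ∷ false ∷ []) _ _ = lose bull∈𝓕 (via (# 1 ∷ # 2 ∷ # 0 ∷ # 5 ∷ # 3 ∷ []))
C₅+vertex-contains-𝓕 (true ∷ true ∷ false ∷ false ∷ true ∷ []) _ _ = lose co-twin-C5∈𝓕 (via (# 3 ∷ # 2 ∷ # 1 ∷ # 5 ∷ # 4 ∷ # 0 ∷ []))
C₅+vertex-contains-𝓕 (true ∷ true ∷ false ∷ true ∷ false ∷ []) _ _ = lose bull∈𝓕 (via (# 1 ∷ # 2 ∷ # 0 ∷ # 5 ∷ # 3 ∷ []))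
C₅+vertex-contains-𝓕 (true ∷ true ∷ false ∷ true ∷ true ∷ []) _ _ = lose house∈𝓕 (via (# 2 ∷ # 1 ∷ # 0 ∷ # 4 ∷ # 3 ∷ []))
C₅+vertex-contains-𝓕 (true ∷ true ∷ true ∷ false ∷ false ∷ []) _ _ = lose co-twin-C5∈𝓕 (via (# 4 ∷ # 3 ∷ # 2 ∷ # 1 ∷ # 5 ∷ # 0 ∷ []))
C₅+vertex-contains-𝓕 (true ∷ true ∷ true ∷ false ∷ true ∷ []) _ _ = lose house∈𝓕 (via (# 3 ∷ # 2 ∷ # 0 ∷ # 5 ∷ # 4 ∷ []))
C₅+vertex-contains-𝓕 (true ∷ true ∷ true ∷ true ∷ false ∷ []) _ _ = lose house∈𝓕 (via (# 1 ∷ # 2 ∷ # 0 ∷ # 4 ∷ # 5 ∷ []))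
C₅+vertex-contains-𝓕 (true ∷ true ∷ true ∷ true ∷ true ∷ []) _ _ = lose gem∈𝓕 (via (# 1 ∷ # 2 ∷ # 3 ∷ # 4 ∷ # 0 ∷ []))

induced-C₅-closed : (G : Graph) → FFree G → ((f , _) : cycleAdj 5 ↪ adj G) →
                    ∀ {i v} → adj G (f i) v ≡ true → ∃ λ j → f j ≡ v
induced-C₅-closed G FF e@(f , _) {i} {v} fi~v with any? (λ j → f j ≟ v)
... | yes v∈f = v∈f
... | no  v∉f = contradiction 𝓕-in-G (FFree⇒¬Contains-𝓕 G FF)
  where
  neighbourhood : Fin 5 → Bool
  neighbourhood j = adj G (f j) v

  N : Vec Bool 5
  N = tabulate neighbourhood

  C₅+v↪G : addVertex (lookup N) (cycleAdj 5) ↪ adj G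
  C₅+v↪G = addVertex-↪ G e v∉f λ j → sym (lookup∘tabulate neighbourhood j)

  𝓕-in-G : Any (Contains (adj G)) 𝓕
  𝓕-in-G = Any.map (λ c → ↪-trans c C₅+v↪G)
    (C₅+vertex-contains-𝓕 N i (trans (lookup∘tabulate neighbourhood i) fi~v))

walk-preserves : (G : Graph) (P : Fin (n G) → Set) →
                 (∀ {u v} → adj G u v ≡ true → P u → P v) →
                 ∀ {u v} → Walk G u v → P u → P v
walk-preserves G P closed here         pu = pu
walk-preserves G P closed (step uv vw) pu = walk-preserves G P closed vw (closed uv pu)

mainTheorem2 : (G : Graph) → Connected G → FFree G → OddHoles7Free G →
    HasInduced G 5 (cycleAdj 5) → IsoTo G 5 (cycleAdj 5)
mainTheorem2 G connected FF _ C₅@(f , f-inj , f-adj) =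
  f , (f-inj , strictlySurjective⇒surjective onto) , f-adj
  where
  Image : Fin (n G) → Set
  Image v = ∃ λ i → f i ≡ v

  image-closed : ∀ {u v} → adj G u v ≡ true → Image u → Image v
  image-closed uv (i , refl) = induced-C₅-closed G FF (HasInduced⇒↪ G C₅) uv

  onto : ∀ v → Image v
  onto v = walk-preserves G Image image-closed (connected (f zero) v) (zero , refl)
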